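{- Every pointed lattice satisfying the quasi-equation $x\vee y\geq\mathsf{1}\implies(x\wedge z)\vee(y\wedge z)\geq\mathsf{1}\wedge z$ is up-distributive at $\mathsf{1}$.
   Context: A pointed lattice is a lattice with a constant $\mathsf{1}$. It is up-distributive at $\mathsf{1}$ if for all $x,y,z$: $x\vee y\geq\mathsf{1}$ and $x\vee z\geq\mathsf{1}$ imply $x\vee(y\wedge z)\geq\mathsf{1}$. -}

module Defs where

open import Level using (Level)
open import Relation.Binary.Lattice using (Lattice)

UpDistributiveAt : ∀ {c ℓ₁ ℓ₂} (L : Lattice c ℓ₁ ℓ₂) → Lattice.Carrier L → Set _
UpDistributiveAt L 𝟙 = ∀ x y z → 𝟙 ≤ x ∨ y → 𝟙 ≤ x ∨ z → 𝟙 ≤ x ∨ (y ∧ z)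
  where open Lattice L

QuasiEq : ∀ {c ℓ₁ ℓ₂} (L : Lattice c ℓ₁ ℓ₂) → Lattice.Carrier L → Set _
QuasiEq L 𝟙 = ∀ x y z → 𝟙 ≤ x ∨ y → 𝟙 ∧ z ≤ (x ∧ z) ∨ (y ∧ z)
  where open Lattice L

{-# OPTIONS --safe #-}
module Submission where

open import Defs
open import Relation.Binary.Lattice using (Lattice)
import Relation.Binary.Lattice.Properties.JoinSemilattice as JoinProperties
import Relation.Binary.Lattice.Properties.MeetSemilattice as MeetProperties
import Relation.Binary.Reasoning.PartialOrder as ≤-Reasoning

-- Two instances of the quasi-equation: meeting 1 ≤ x ∨ y with 1 shows that
-- 1 ≤ x ∨ (1 ∧ y), and meeting 1 ≤ z ∨ x with y shows that 1 ∧ y lies below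
-- x ∨ (y ∧ z).

module QuasiEqLattice {c ℓ₁ ℓ₂} (L : Lattice c ℓ₁ ℓ₂) (𝟙 : Lattice.Carrier L)
                      (quasiEq : QuasiEq L 𝟙) where

  open Lattice L
  open JoinProperties joinSemilattice using (∨-monotonic; ∨-comm)
  open MeetProperties meetSemilattice using (∧-comm; ∧-idempotent)
  open ≤-Reasoning poset

  1≤x∨y⇒1≤x∨[1∧y] : ∀ {x y} → 𝟙 ≤ x ∨ y → 𝟙 ≤ x ∨ (𝟙 ∧ y)
  1≤x∨y⇒1≤x∨[1∧y] {x} {y} 1≤x∨y = begin
    𝟙                   ≈⟨ Eq.sym (∧-idempotent 𝟙) ⟩
    𝟙 ∧ 𝟙               ≤⟨ quasiEq x y 𝟙 1≤x∨y ⟩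
    (x ∧ 𝟙) ∨ (y ∧ 𝟙)   ≤⟨ ∨-monotonic (x∧y≤x x 𝟙) (reflexive (∧-comm y 𝟙)) ⟩
    x ∨ (𝟙 ∧ y)         ∎

  1≤x∨z⇒1∧y≤x∨[y∧z] : ∀ {x y z} → 𝟙 ≤ x ∨ z → 𝟙 ∧ y ≤ x ∨ (y ∧ z)
  1≤x∨z⇒1∧y≤x∨[y∧z] {x} {y} {z} 1≤x∨z = begin
    𝟙 ∧ y               ≤⟨ quasiEq z x y (trans 1≤x∨z (reflexive (∨-comm x z))) ⟩
    (z ∧ y) ∨ (x ∧ y)   ≈⟨ ∨-comm (z ∧ y) (x ∧ y) ⟩
    (x ∧ y) ∨ (z ∧ y)   ≤⟨ ∨-monotonic (x∧y≤x x y) (reflexive (∧-comm z y)) ⟩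
    x ∨ (y ∧ z)         ∎

lemma2p8 : ∀ {c ℓ₁ ℓ₂} (L : Lattice c ℓ₁ ℓ₂) (𝟙 : Lattice.Carrier L) →
    QuasiEq L 𝟙 → UpDistributiveAt L 𝟙
lemma2p8 L 𝟙 quasiEq x y z 1≤x∨y 1≤x∨z = begin
  𝟙             ≤⟨ 1≤x∨y⇒1≤x∨[1∧y] 1≤x∨y ⟩
  x ∨ (𝟙 ∧ y)   ≤⟨ ∨-least (x≤x∨y x (y ∧ z)) (1≤x∨z⇒1∧y≤x∨[y∧z] 1≤x∨z) ⟩
  x ∨ (y ∧ z)   ∎
  where
  open Lattice L
  open QuasiEqLattice L 𝟙 quasiEq
  open ≤-Reasoning poset
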